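{- For integers $n,h\geq 0$, let $c_n^{(h)}$ be the number of independent sets (including the empty set) of $\mathbf{C}_n^{(h)}$. Then $c_n^{(h)}=n+1$ if $n\leq 2h+1$, and $c_n^{(h)}=c_{n-1}^{(h)}+c_{n-h-1}^{(h)}$ if $n>2h+1$.
   Context: For $n,h\geq 0$, the $h$-power of a cycle $\mathbf{C}_n^{(h)}$ is the graph with vertices $v_1,\dots,v_n$ in which, for $i\neq j$, $v_i$ and $v_j$ are adjacent if and only if $|j-i|\leq h$ or $|j-i|\geq n-h$. An independent set of a graph is a subset of its vertex set containing no two adjacent vertices. -}

module Defs where

open import Data.Nat using (ℕ; zero; suc; _+_; _∸_; _≤_; _≤?_)
open import Data.Nat.Properties using (_≟_)
open import Data.Fin using (Fin; toℕ)
open import Data.Fin.Properties using (all?)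
open import Data.Fin.Subset using (Subset; _∈_)
open import Data.Fin.Subset.Properties using (_∈?_)
open import Data.Bool using (true; false)
open import Data.Vec using (Vec; []; _∷_)
open import Data.List using (List; []; _∷_; map; _++_; filter; length)
open import Data.Sum using (_⊎_)
open import Data.Product using (_×_)
open import Relation.Nullary using (¬_; Dec; yes; no)
open import Relation.Nullary.Decidable using (_⊎-dec_; _×-dec_; ¬?; _→-dec_)

dist : ℕ → ℕ → ℕ
dist x y = (x ∸ y) + (y ∸ x)

-- Adjacency in the h-th power of the cycle C_n^{(h)} on vertices v_1..v_n,
-- represented by Fin n (vertex v_{i+1} ↔ i).  For i ≠ j:
-- adjacent iff |j - i| ≤ h or |j - i| ≥ n - h.
Adjacent : (n h : ℕ) → Fin n → Fin n → Set
Adjacent n h i j =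
  ¬ (toℕ i ≡ toℕ j) × (dist (toℕ i) (toℕ j) ≤ h ⊎ n ∸ h ≤ dist (toℕ i) (toℕ j))
  where open import Relation.Binary.PropositionalEquality using (_≡_)

adjacent? : (n h : ℕ) → (i j : Fin n) → Dec (Adjacent n h i j)
adjacent? n h i j =
  ¬? (toℕ i ≟ toℕ j) ×-dec
  ((dist (toℕ i) (toℕ j) ≤? h) ⊎-dec (n ∸ h ≤? dist (toℕ i) (toℕ j)))

Independent : (n h : ℕ) → Subset n → Set
Independent n h S = ∀ i j → i ∈ S → j ∈ S → ¬ Adjacent n h i j

independent? : (n h : ℕ) → (S : Subset n) → Dec (Independent n h S)
independent? n h S =
  all? λ i → all? λ j → (i ∈? S) →-dec ((j ∈? S) →-dec ¬? (adjacent? n h i j))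

allSubsets : (n : ℕ) → List (Subset n)
allSubsets zero = [] ∷ []
allSubsets (suc n) = map (true ∷_) (allSubsets n) ++ map (false ∷_) (allSubsets n)

c : (n h : ℕ) → ℕ
c n h = length (filter (independent? n h) (allSubsets n))

module Submission where

-- Number the vertices of C_n^(h) by 0,…,n-1.  A set S is
-- independent iff any two members a < b satisfy h < b - a < n - h: the
-- gap is larger than h both along the path and around the cycle.  We count
-- such gap-constrained subsets of {0,…,m-1} by deciding whether the first
-- position is used, which yields recursions for two families:
--   * subsets of a window [lo, hi) with all gaps > h, counted by the
--     sequence  pathCount h  (pathCount (x+1) = pathCount x + pathCount (x-h),
--     pathCount 0 = 1), i.e. independent sets of the h-th power of a path;
--   * subsets whose gaps lie in the open interval (h, k).
-- Taking k = n - h gives the closed form, for n ≥ h + 1,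
--   c_n = cycleCount (n-h-1),   cycleCount a = pathCount a + (h+1) pathCount (a-h),
-- while for n ≤ 2h+1 the same count collapses to n + 1.  The recurrence of
-- the theorem is then the recurrence cycleCount inherits from pathCount.

open import Defs
open import Level using (0ℓ)
open import Data.Nat
  using (ℕ; zero; suc; pred; _+_; _∸_; _*_; _⊓_; _≤_; _<_; _>_; z≤n; s≤s; s≤s⁻¹; _≤?_; _<?_)
open import Data.Nat.Properties
open import Data.Nat.Tactic.RingSolver using (solve-∀)
open import Data.Fin using (zero; suc; toℕ)
open import Data.Fin.Properties using (all?)
open import Data.Fin.Subset using (Subset; _∈_)
open import Data.Fin.Subset.Properties using (_∈?_)
open import Data.Bool using (true; false)
open import Data.Vec using ([]; _∷_; here; there)
open import Data.List using (List; []; _∷_; map; _++_; filter; length)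
open import Data.List.Properties using (length-++; filter-++; filter-≐; filter-none; filter-accept)
open import Data.List.Relation.Unary.All using (tabulate)
open import Data.Product using (_×_; _,_; proj₁)
open import Data.Sum using (_⊎_; inj₁; inj₂)
open import Function using (_∘_)
open import Relation.Nullary using (¬_; Dec; yes; no; does)
open import Relation.Nullary.Decidable using (_×-dec_; _→-dec_; map′)
open import Relation.Unary using (Pred; Decidable; _≐_; Empty)
open import Relation.Binary using (tri<; tri≈; tri>)
open import Relation.Binary.PropositionalEquality

count : ∀ {m} {P : Pred (Subset m) 0ℓ} → Decidable P → ℕ
count {m} P? = length (filter P? (allSubsets m))

length-filter-map : ∀ {A B : Set} {P : Pred B 0ℓ} (P? : Decidable P) (f : A → B) (xs : List A)
  → length (filter P? (map f xs)) ≡ length (filter (P? ∘ f) xs)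
length-filter-map P? f [] = refl
length-filter-map P? f (x ∷ xs) with does (P? (f x))
... | true  = cong suc (length-filter-map P? f xs)
... | false = length-filter-map P? f xs

count-cong : ∀ {m} {P Q : Pred (Subset m) 0ℓ} (P? : Decidable P) (Q? : Decidable Q)
  → P ≐ Q → count P? ≡ count Q?
count-cong {m} P? Q? P≐Q = cong length (filter-≐ P? Q? P≐Q (allSubsets m))

count-∷ : ∀ {m} {P : Pred (Subset (suc m)) 0ℓ} (P? : Decidable P)
  → count P? ≡ count (P? ∘ (true ∷_)) + count (P? ∘ (false ∷_))
count-∷ {m} P? = begin
    length (filter P? (map (true ∷_) Ss ++ map (false ∷_) Ss))
  ≡⟨ cong length (filter-++ P? (map (true ∷_) Ss) _) ⟩
    length (filter P? (map (true ∷_) Ss) ++ filter P? (map (false ∷_) Ss))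
  ≡⟨ length-++ (filter P? (map (true ∷_) Ss)) ⟩
    length (filter P? (map (true ∷_) Ss)) + length (filter P? (map (false ∷_) Ss))
  ≡⟨ cong₂ _+_ (length-filter-map P? (true ∷_) Ss) (length-filter-map P? (false ∷_) Ss) ⟩
    count (P? ∘ (true ∷_)) + count (P? ∘ (false ∷_)) ∎
  where
  open ≡-Reasoning
  Ss = allSubsets m

count-none : ∀ {m} {P : Pred (Subset m) 0ℓ} (P? : Decidable P) → Empty P → count P? ≡ 0
count-none {m} P? none = cong length (filter-none P? {allSubsets m} (tabulate (λ {S} _ → none S)))

count-[] : ∀ {P : Pred (Subset 0) 0ℓ} (P? : Decidable P) → P [] → count P? ≡ 1
count-[] P? p = cong length (filter-accept P? p)

-- Two ways of constraining a subset of Fin m through the positions of its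
-- members: a condition on every member, and a condition on every pair of
-- members a < b.  (Records, so that the condition can be inferred.)
record Every {m} (P : Pred ℕ 0ℓ) (S : Subset m) : Set where
  constructor every
  field member : ∀ j → j ∈ S → P (toℕ j)

record Pairwise {m} (R : ℕ → ℕ → Set) (S : Subset m) : Set where
  constructor pairwise
  field pair : ∀ i j → i ∈ S → j ∈ S → toℕ i < toℕ j → R (toℕ i) (toℕ j)

every? : ∀ {m} {P : Pred ℕ 0ℓ} → Decidable P → Decidable (Every {m} P)
every? P? S = map′ every Every.member (all? λ j → (j ∈? S) →-dec P? (toℕ j))

pairwise? : ∀ {m} {R : ℕ → ℕ → Set} → (∀ a b → Dec (R a b)) → Decidable (Pairwise {m} R)
pairwise? R? S = map′ pairwise Pairwise.pair
  (all? λ i → all? λ j → (i ∈? S) →-dec ((j ∈? S) →-dec ((toℕ i <? toℕ j) →-dec R? (toℕ i) (toℕ j))))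

module _ {m} {S : Subset m} where

  every-tail : ∀ {P b} → Every P (b ∷ S) → Every (P ∘ suc) S
  every-tail (every ev) = every λ j j∈ → ev (suc j) (there j∈)

  every-false : ∀ {P} → Every (P ∘ suc) S → Every P (false ∷ S)
  every-false (every ev) = every λ where (suc j) (there j∈) → ev j j∈

  every-head : ∀ {P} → Every P (true ∷ S) → P 0
  every-head (every ev) = ev zero here

  every-true : ∀ {P} → P 0 → Every (P ∘ suc) S → Every P (true ∷ S)
  every-true p0 (every ev) = every λ where
    zero    here       → p0
    (suc j) (there j∈) → ev j j∈

  every-map : ∀ {P Q} → (∀ {x} → P x → Q x) → Every P S → Every Q S
  every-map f (every ev) = every λ j j∈ → f (ev j j∈)

  pairwise-tail : ∀ {R b} → Pairwise R (b ∷ S) → Pairwise (λ x y → R (suc x) (suc y)) S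
  pairwise-tail (pairwise pw) = pairwise λ i j i∈ j∈ i<j → pw (suc i) (suc j) (there i∈) (there j∈) (s≤s i<j)

  pairwise-false : ∀ {R} → Pairwise (λ x y → R (suc x) (suc y)) S → Pairwise R (false ∷ S)
  pairwise-false (pairwise pw) = pairwise λ where
    (suc i) (suc j) (there i∈) (there j∈) i<j → pw i j i∈ j∈ (s≤s⁻¹ i<j)

  pairwise-head : ∀ {R} → Pairwise R (true ∷ S) → Every (R 0 ∘ suc) S
  pairwise-head (pairwise pw) = every λ j j∈ → pw zero (suc j) here (there j∈) (s≤s z≤n)

  pairwise-true : ∀ {R} → Every (R 0 ∘ suc) S → Pairwise (λ x y → R (suc x) (suc y)) S
    → Pairwise R (true ∷ S)
  pairwise-true (every ev) (pairwise pw) = pairwise λ where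
    zero    (suc j) here       (there j∈) _   → ev j j∈
    (suc i) (suc j) (there i∈) (there j∈) i<j → pw i j i∈ j∈ (s≤s⁻¹ i<j)

  every-zip : ∀ {P Q T} → (∀ {x} → P x → Q x → T x) → Every P S → Every Q S → Every T S
  every-zip f (every ev) (every ev′) = every λ j j∈ → f (ev j j∈) (ev′ j j∈)

  pairwise-map : ∀ {R Q} → (∀ {a b} → R a b → Q a b) → Pairwise R S → Pairwise Q S
  pairwise-map f (pairwise pw) = pairwise λ i j i∈ j∈ i<j → f (pw i j i∈ j∈ i<j)

  pairwise-weaken : ∀ {P R Q} → (∀ {a b} → P a → P b → R a b → Q a b)
    → Every P S → Pairwise R S → Pairwise Q S
  pairwise-weaken f (every ev) (pairwise pw) =
    pairwise λ i j i∈ j∈ i<j → f (ev i i∈) (ev j j∈) (pw i j i∈ j∈ i<j)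

Gap : ℕ → ℕ → ℕ → Set
Gap h a b = h < b ∸ a

CyclicGap : ℕ → ℕ → ℕ → ℕ → Set
CyclicGap h k a b = h < b ∸ a × b ∸ a < k

Window : ℕ → ℕ → ℕ → Set
Window lo hi x = lo ≤ x × x < hi

-- Subsets of the window [lo, hi) with all gaps larger than h, i.e. the
-- independent sets of the h-th power of a path on [lo, hi).
SparseIn : ∀ {m} → ℕ → ℕ → ℕ → Subset m → Set
SparseIn h lo hi S = Pairwise (Gap h) S × Every (Window lo hi) S

sparseIn? : ∀ h lo hi {m} → Decidable (SparseIn {m} h lo hi)
sparseIn? h lo hi S =
  pairwise? (λ a b → h <? b ∸ a) S ×-dec every? (λ x → (lo ≤? x) ×-dec (x <? hi)) S

cyclicSparse? : ∀ h k {m} → Decidable (Pairwise {m} (CyclicGap h k))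
cyclicSparse? h k = pairwise? (λ a b → (h <? b ∸ a) ×-dec (b ∸ a <? k))

window-pred : ∀ {lo hi x} → Window lo hi (suc x) → Window (pred lo) (pred hi) x
window-pred (lo≤ , <hi) = pred-mono-≤ lo≤ , pred-mono-≤ <hi

window-suc : ∀ {lo hi x} → Window (pred lo) (pred hi) x → Window lo hi (suc x)
window-suc {zero}  (_ , <hi) = z≤n , pred-cancel-< <hi
window-suc {suc l} (l≤ , <hi) = s≤s l≤ , pred-cancel-< <hi

module _ {m : ℕ} (h : ℕ) where

  sparseIn-false : ∀ lo hi
    → (SparseIn h lo hi ∘ (false ∷_)) ≐ SparseIn {m} h (pred lo) (pred hi)
  sparseIn-false lo hi =
    (λ (pw , ev) → pairwise-tail pw , every-map window-pred (every-tail ev)) ,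
    (λ (pw , ev) → pairwise-false pw , every-false (every-map window-suc ev))

  sparseIn-true-empty : ∀ lo hi → ¬ Window lo hi 0 → Empty (SparseIn {suc m} h lo hi ∘ (true ∷_))
  sparseIn-true-empty lo hi ∉window S (_ , ev) = ∉window (every-head ev)

  sparseIn-true : ∀ hi → (SparseIn h 0 (suc hi) ∘ (true ∷_)) ≐ SparseIn {m} h h hi
  sparseIn-true hi =
    (λ (pw , ev) → pairwise-tail pw ,
                   every-zip (λ h<x (_ , x<hi) → s≤s⁻¹ h<x , s≤s⁻¹ x<hi)
                             (pairwise-head pw) (every-tail ev)) ,
    (λ (pw , ev) → pairwise-true (every-map (s≤s ∘ proj₁) ev) pw ,
                   every-true (z≤n , s≤s z≤n) (every-map (λ (_ , x<hi) → z≤n , s≤s x<hi) ev))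

  cyclic-false : ∀ k → (Pairwise (CyclicGap h k) ∘ (false ∷_)) ≐ Pairwise {m} (CyclicGap h k)
  cyclic-false k = pairwise-tail , pairwise-false

  -- With the first position used, the others, renumbered from 0, lie in
  -- [h, k - 1) and then automatically have mutual distance less than k.
  cyclic-true : ∀ k → (Pairwise (CyclicGap h k) ∘ (true ∷_)) ≐ SparseIn {m} h h (pred k)
  cyclic-true k =
    (λ pw → pairwise-map proj₁ (pairwise-tail pw) ,
            every-map (λ (h<x , x<k) → s≤s⁻¹ h<x , <⇒≤pred x<k) (pairwise-head pw)) ,
    (λ (pw , ev) → pairwise-true (every-map (λ (h≤x , x<K) → s≤s h≤x , pred-cancel-< x<K) ev)
                                 (pairwise-weaken below-k ev pw))
    where
    below-k : ∀ {a b} → Window h (pred k) a → Window h (pred k) b → Gap h a b → CyclicGap h k a b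
    below-k {a} {b} _ (_ , b<K) gap = gap , ≤-<-trans (m∸n≤m b a) (<-≤-trans b<K pred[n]≤n)

-- pathCount h x counts the h-sparse subsets of {0,…,x-1} (the independent
-- sets of the h-th power of a path on x vertices).  It is determined by
--   pathCount 0 = 1,   pathCount (x+1) = pathCount x + pathCount (x ∸ h);
-- since x ∸ h is not structurally smaller than x + 1, the recursion is run
-- with an explicit fuel bound.
module _ (h : ℕ) where

  pathCountWithin : ℕ → ℕ → ℕ
  pathCountWithin _       zero    = 1
  pathCountWithin zero    (suc x) = 0
  pathCountWithin (suc f) (suc x) = pathCountWithin f x + pathCountWithin f (x ∸ h)

  pathCountWithin-fuel : ∀ f g x → x ≤ f → x ≤ g → pathCountWithin f x ≡ pathCountWithin g x
  pathCountWithin-fuel f       g       zero    _         _         = refl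
  pathCountWithin-fuel (suc f) (suc g) (suc x) (s≤s x≤f) (s≤s x≤g) =
    cong₂ _+_ (pathCountWithin-fuel f g x x≤f x≤g)
              (pathCountWithin-fuel f g (x ∸ h) (≤-trans (m∸n≤m x h) x≤f) (≤-trans (m∸n≤m x h) x≤g))

  pathCount : ℕ → ℕ
  pathCount x = pathCountWithin x x

  pathCount-suc : ∀ x → pathCount (suc x) ≡ pathCount x + pathCount (x ∸ h)
  pathCount-suc x = cong (pathCount x +_) (pathCountWithin-fuel x (x ∸ h) (x ∸ h) (m∸n≤m x h) ≤-refl)

  -- On at most h + 1 vertices only the empty set and the singletons are sparse.
  pathCount-small : ∀ x → x ≤ suc h → pathCount x ≡ suc x
  pathCount-small zero    _         = refl
  pathCount-small (suc x) (s≤s x≤h) = begin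
      pathCount (suc x)
    ≡⟨ pathCount-suc x ⟩
      pathCount x + pathCount (x ∸ h)
    ≡⟨ cong₂ _+_ (pathCount-small x (m≤n⇒m≤1+n x≤h)) (cong pathCount (m≤n⇒m∸n≡0 x≤h)) ⟩
      suc x + 1
    ≡⟨ +-comm (suc x) 1 ⟩
      suc (suc x) ∎
    where open ≡-Reasoning

module _ (h : ℕ) where

  count-outside : ∀ {m} lo hi → ¬ Window lo hi 0
    → count (sparseIn? h lo hi {suc m}) ≡ count (sparseIn? h (pred lo) (pred hi) {m})
  count-outside {m} lo hi 0∉ = trans (count-∷ P?)
    (cong₂ _+_ (count-none (P? ∘ (true ∷_)) (sparseIn-true-empty h lo hi 0∉))
               (count-cong (P? ∘ (false ∷_)) (sparseIn? h (pred lo) (pred hi)) (sparseIn-false h lo hi)))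
    where P? = sparseIn? h lo hi {suc m}

  count-sparseIn : ∀ m lo hi → count (sparseIn? h lo hi {m}) ≡ pathCount h (m ⊓ hi ∸ lo)
  count-sparseIn zero lo hi =
    trans (count-[] (sparseIn? h lo hi {0}) (pairwise (λ ()) , every (λ ())))
          (cong (pathCount h) (sym (0∸n≡0 lo)))
  count-sparseIn (suc m) (suc lo) hi =
    trans (count-outside {m} (suc lo) hi (λ ()))
          (trans (count-sparseIn m lo (pred hi)) (cong (pathCount h) (shrink hi)))
    where
    shrink : ∀ hi → m ⊓ pred hi ∸ lo ≡ suc m ⊓ hi ∸ suc lo
    shrink zero    = trans (cong (_∸ lo) (⊓-zeroʳ m)) (0∸n≡0 lo)
    shrink (suc _) = refl
  count-sparseIn (suc m) zero zero =
    trans (count-outside {m} 0 0 (λ ())) (trans (count-sparseIn m 0 0) (cong (pathCount h) (⊓-zeroʳ m)))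
  count-sparseIn (suc m) zero (suc hi) = begin
      count (sparseIn? h 0 (suc hi) {suc m})
    ≡⟨ count-∷ P? ⟩
      count (P? ∘ (true ∷_)) + count (P? ∘ (false ∷_))
    ≡⟨ cong₂ _+_ (count-cong (P? ∘ (true ∷_)) (sparseIn? h h hi) (sparseIn-true h hi))
                 (count-cong (P? ∘ (false ∷_)) (sparseIn? h 0 hi) (sparseIn-false h 0 (suc hi))) ⟩
      count (sparseIn? h h hi {m}) + count (sparseIn? h 0 hi {m})
    ≡⟨ cong₂ _+_ (count-sparseIn m h hi) (count-sparseIn m 0 hi) ⟩
      pathCount h (m ⊓ hi ∸ h) + pathCount h (m ⊓ hi)
    ≡⟨ +-comm (pathCount h (m ⊓ hi ∸ h)) _ ⟩
      pathCount h (m ⊓ hi) + pathCount h (m ⊓ hi ∸ h)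
    ≡⟨ sym (pathCount-suc h (m ⊓ hi)) ⟩
      pathCount h (suc m ⊓ suc hi) ∎
    where
    open ≡-Reasoning
    P? = sparseIn? h 0 (suc hi) {suc m}

  -- The closed form for subsets of Fin m whose gaps lie strictly between h
  -- and K + 1: pathCount (min(m, K)) + (m ∸ K) · pathCount (K ∸ h).
  cyclicFormula : ℕ → ℕ → ℕ
  cyclicFormula K m = pathCount h (m ⊓ K) + (m ∸ K) * pathCount h (K ∸ h)

  cyclicFormula-suc : ∀ K m → cyclicFormula K (suc m) ≡ pathCount h (m ⊓ K ∸ h) + cyclicFormula K m
  cyclicFormula-suc K m with m <? K
  ... | yes m<K
    rewrite m≤n⇒m⊓n≡m m<K | m≤n⇒m⊓n≡m (<⇒≤ m<K) | m≤n⇒m∸n≡0 m<K | m≤n⇒m∸n≡0 (<⇒≤ m<K)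
          | pathCount-suc h m =
    rearrange (pathCount h m) (pathCount h (m ∸ h))
    where
    rearrange : ∀ x y → (x + y) + 0 ≡ y + (x + 0)
    rearrange = solve-∀
  ... | no m≮K
    rewrite m≥n⇒m⊓n≡n (≮⇒≥ m≮K) | m≥n⇒m⊓n≡n (m≤n⇒m≤1+n (≮⇒≥ m≮K)) | +-∸-assoc 1 (≮⇒≥ m≮K) =
    rearrange (pathCount h K) (pathCount h (K ∸ h)) (m ∸ K)
    where
    rearrange : ∀ x y d → x + (1 + d) * y ≡ y + (x + d * y)
    rearrange = solve-∀

  count-cyclic : ∀ k m → count (cyclicSparse? h k {m}) ≡ cyclicFormula (pred k) m
  count-cyclic k zero =
    trans (count-[] (cyclicSparse? h k) (pairwise λ ()))
          (cong (λ d → 1 + d * pathCount h (pred k ∸ h)) (sym (0∸n≡0 (pred k))))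
  count-cyclic k (suc m) = begin
      count P?
    ≡⟨ count-∷ P? ⟩
      count (P? ∘ (true ∷_)) + count (P? ∘ (false ∷_))
    ≡⟨ cong₂ _+_ (count-cong (P? ∘ (true ∷_)) (sparseIn? h h (pred k)) (cyclic-true h k))
                 (count-cong (P? ∘ (false ∷_)) (cyclicSparse? h k) (cyclic-false h k)) ⟩
      count (sparseIn? h h (pred k) {m}) + count (cyclicSparse? h k {m})
    ≡⟨ cong₂ _+_ (count-sparseIn m h (pred k)) (count-cyclic k m) ⟩
      pathCount h (m ⊓ pred k ∸ h) + cyclicFormula (pred k) m
    ≡⟨ sym (cyclicFormula-suc (pred k) m) ⟩
      cyclicFormula (pred k) (suc m) ∎
    where
    open ≡-Reasoning
    P? = cyclicSparse? h k {suc m}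

dist-< : ∀ {a b} → a < b → dist a b ≡ b ∸ a
dist-< {a} {b} a<b = cong (_+ (b ∸ a)) (m≤n⇒m∸n≡0 (<⇒≤ a<b))

module _ (n h : ℕ) where

  adjacent-sym : ∀ {i j} → Adjacent n h i j → Adjacent n h j i
  adjacent-sym {i} {j} (i≢j , close) =
    i≢j ∘ sym , subst (λ d → d ≤ h ⊎ n ∸ h ≤ d) (+-comm (toℕ i ∸ toℕ j) (toℕ j ∸ toℕ i)) close

  nonAdjacent⇒gap : ∀ {i j} → toℕ i < toℕ j → ¬ Adjacent n h i j
    → CyclicGap h (n ∸ h) (toℕ i) (toℕ j)
  nonAdjacent⇒gap i<j ¬adj =
    ≰⇒> (λ d≤h → ¬adj (<⇒≢ i<j , inj₁ (subst (_≤ h) (sym (dist-< i<j)) d≤h))) ,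
    ≰⇒> (λ k≤d → ¬adj (<⇒≢ i<j , inj₂ (subst (n ∸ h ≤_) (sym (dist-< i<j)) k≤d)))

  gap⇒nonAdjacent : ∀ {i j} → toℕ i < toℕ j → CyclicGap h (n ∸ h) (toℕ i) (toℕ j)
    → ¬ Adjacent n h i j
  gap⇒nonAdjacent i<j (h<d , _) (_ , inj₁ d≤h) = <⇒≱ h<d (subst (_≤ h) (dist-< i<j) d≤h)
  gap⇒nonAdjacent i<j (_ , d<k) (_ , inj₂ k≤d) = <⇒≱ d<k (subst (n ∸ h ≤_) (dist-< i<j) k≤d)

  cyclicSparse⇒independent : ∀ {S} → Pairwise (CyclicGap h (n ∸ h)) S → Independent n h S
  cyclicSparse⇒independent (pairwise pw) i j i∈ j∈ with <-cmp (toℕ i) (toℕ j)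
  ... | tri< i<j _ _ = gap⇒nonAdjacent i<j (pw i j i∈ j∈ i<j)
  ... | tri≈ _ i≡j _ = λ (i≢j , _) → i≢j i≡j
  ... | tri> _ _ j<i = gap⇒nonAdjacent j<i (pw j i j∈ i∈ j<i) ∘ adjacent-sym

  independent≐cyclicSparse : Independent n h ≐ Pairwise (CyclicGap h (n ∸ h))
  independent≐cyclicSparse =
    (λ ind → pairwise λ i j i∈ j∈ i<j → nonAdjacent⇒gap i<j (ind i j i∈ j∈)) ,
    cyclicSparse⇒independent

  c-closed : c n h ≡ cyclicFormula h (pred (n ∸ h)) n
  c-closed = trans (count-cong (independent? n h) (cyclicSparse? h (n ∸ h)) independent≐cyclicSparse)
                   (count-cyclic h (n ∸ h) n)

module _ (h : ℕ) where

  -- With K ≤ h no two positions can be used, leaving the empty set and the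
  -- n singletons.
  cyclicFormula-small : ∀ {K n} → K ≤ h → K ≤ n → cyclicFormula h K n ≡ suc n
  cyclicFormula-small {K} {n} K≤h K≤n = begin
      pathCount h (n ⊓ K) + (n ∸ K) * pathCount h (K ∸ h)
    ≡⟨ cong₂ (λ x y → pathCount h x + (n ∸ K) * pathCount h y) (m≥n⇒m⊓n≡n K≤n) (m≤n⇒m∸n≡0 K≤h) ⟩
      pathCount h K + (n ∸ K) * 1
    ≡⟨ cong₂ _+_ (pathCount-small h K (m≤n⇒m≤1+n K≤h)) (*-identityʳ (n ∸ K)) ⟩
      suc K + (n ∸ K)
    ≡⟨ cong suc (m+[n∸m]≡n K≤n) ⟩
      suc n ∎
    where open ≡-Reasoning

  -- cycleCount a is the number of independent sets of C^(h) on a + h + 1 vertices.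
  cycleCount : ℕ → ℕ
  cycleCount a = pathCount h a + (h + 1) * pathCount h (a ∸ h)

  c-cycleCount : ∀ {n} → h < n → c n h ≡ cycleCount (n ∸ (h + 1))
  c-cycleCount {n} h<n = begin
      c n h
    ≡⟨ c-closed n h ⟩
      cyclicFormula h (pred (n ∸ h)) n
    ≡⟨ cong (λ K → cyclicFormula h K n) (trans (pred[m∸n]≡m∸[1+n] n h) (cong (n ∸_) (+-comm 1 h))) ⟩
      pathCount h (n ⊓ a) + (n ∸ a) * pathCount h (a ∸ h)
    ≡⟨ cong₂ (λ x y → pathCount h x + y * pathCount h (a ∸ h))
             (m≥n⇒m⊓n≡n (m∸n≤m n (h + 1))) (m∸[m∸n]≡n (subst (_≤ n) (+-comm 1 h) h<n)) ⟩
      cycleCount a ∎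
    where
    open ≡-Reasoning
    a = n ∸ (h + 1)

  cycleCount-rec : ∀ {a} → h < a → cycleCount a ≡ cycleCount (a ∸ 1) + cycleCount (a ∸ (h + 1))
  cycleCount-rec {suc b} (s≤s h≤b) = begin
      pathCount h (suc b) + (h + 1) * pathCount h (suc b ∸ h)
    ≡⟨ cong₂ (λ x y → x + (h + 1) * y) (pathCount-suc h b)
             (trans (cong (pathCount h) (+-∸-assoc 1 h≤b)) (pathCount-suc h (b ∸ h))) ⟩
      (p b + p (b ∸ h)) + (h + 1) * (p (b ∸ h) + p (b ∸ h ∸ h))
    ≡⟨ rearrange (p b) (p (b ∸ h)) (p (b ∸ h ∸ h)) (h + 1) ⟩
      cycleCount b + cycleCount (b ∸ h)
    ≡⟨ cong (λ x → cycleCount b + cycleCount x) (cong (suc b ∸_) (+-comm 1 h)) ⟩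
      cycleCount b + cycleCount (suc b ∸ (h + 1)) ∎
    where
    open ≡-Reasoning
    p = pathCount h
    rearrange : ∀ x y z w → (x + y) + w * (y + z) ≡ (x + w * y) + (y + w * z)
    rearrange = solve-∀

∸-comm : ∀ m a b → m ∸ a ∸ b ≡ m ∸ b ∸ a
∸-comm m a b = begin
    m ∸ a ∸ b   ≡⟨ ∸-+-assoc m a b ⟩
    m ∸ (a + b) ≡⟨ cong (m ∸_) (+-comm a b) ⟩
    m ∸ (b + a) ≡⟨ sym (∸-+-assoc m b a) ⟩
    m ∸ b ∸ a   ∎
  where open ≡-Reasoning

lemma4p2 : (n h : ℕ)
    → (n ≤ 2 * h + 1 → c n h ≡ n + 1)
    × (n > 2 * h + 1 → c n h ≡ c (n ∸ 1) h + c (n ∸ (h + 1)) h)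
lemma4p2 n h = small , large
  where
  open ≡-Reasoning

  small : n ≤ 2 * h + 1 → c n h ≡ n + 1
  small n≤2h+1 = begin
      c n h                             ≡⟨ c-closed n h ⟩
      cyclicFormula h (pred (n ∸ h)) n  ≡⟨ cyclicFormula-small h K≤h (≤-trans pred[n]≤n (m∸n≤m n h)) ⟩
      suc n                             ≡⟨ +-comm 1 n ⟩
      n + 1                             ∎
    where
    twice : ∀ x → 2 * x + 1 ≡ x + suc x
    twice = solve-∀
    K≤h : pred (n ∸ h) ≤ h
    K≤h = pred-mono-≤ (m≤n+o⇒m∸n≤o n h (subst (n ≤_) (twice h) n≤2h+1))

  large : n > 2 * h + 1 → c n h ≡ c (n ∸ 1) h + c (n ∸ (h + 1)) h
  large 2h+1<n = begin
      c n h
    ≡⟨ c-cycleCount h h<n ⟩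
      cycleCount h a
    ≡⟨ cycleCount-rec h h<a ⟩
      cycleCount h (a ∸ 1) + cycleCount h (a ∸ (h + 1))
    ≡⟨ cong (λ x → cycleCount h x + cycleCount h (a ∸ (h + 1))) (∸-comm n (h + 1) 1) ⟩
      cycleCount h (n ∸ 1 ∸ (h + 1)) + cycleCount h (a ∸ (h + 1))
    ≡⟨ sym (cong₂ _+_ (c-cycleCount h h<n∸1) (c-cycleCount h h<a)) ⟩
      c (n ∸ 1) h + c (n ∸ (h + 1)) h ∎
    where
    a = n ∸ (h + 1)
    twice : ∀ x → suc (2 * x + 1) ≡ suc x + (x + 1)
    twice = solve-∀
    h<a : h < a
    h<a = m+n≤o⇒m≤o∸n (suc h) (subst (_≤ n) (twice h) 2h+1<n)
    h<n : h < n
    h<n = <-≤-trans h<a (m∸n≤m n (h + 1))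
    h<n∸1 : h < n ∸ 1
    h<n∸1 = <-≤-trans h<a (∸-monoʳ-≤ n (m≤n+m 1 h))
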